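{- Let $p=(p_1,\dots,p_n)$ be a $D_{\mathbf S}$-parking function, let $w=\Psi(p)$, let $\alpha_k^s$ be the $r$-th letter of $w$, and let $P_r=(q_1,\dots,q_n)$ be the tuple maintained at step $r$ of the construction of $\Psi(p)$. Then for every $i\in[n]$ with $q_i\ge0$, $$p_i-q_i=\big|\{\alpha_j^t: \alpha_j^t<_w\alpha_k^s,\ t\in S^+_{i,j}\}\big|.$$
   Context: Fix $n\ge1$, $[n]=\{1,\dots,n\}$, $[a;b]=\{a,\dots,b\}$. Let $\mathbf S=(S_{i,j})_{1\le i<j\le n}$ be finite sets of integers. For $i<j$: $S^+_{i,j}=\{s>0:s\in S_{i,j}\}$, $S^+_{j,i}=\{s\ge0:-s\in S_{i,j}\}$; $S^+_{i,i}=\emptyset$. $m=\max\bigcup_{i\ne j}S^+_{i,j}$. $D_{\mathbf S}$ is the directed multigraph on $[n+1]$ with $|S^+_{i,j}|$ arcs $(i,j)$ for each ordered pair $i\ne j$ in $[n]$ and one arc $(i,n+1)$ for each $i\in[n]$. $p\in\mathbb Z_{\ge0}^n$ is a $D_{\mathbf S}$-parking function if every nonempty $U\subseteq[n]$ contains $u$ with $p_u<|\{\text{arcs }(u,v): v\notin U\}|$. $\Psi$: for a $D_{\mathbf S}$-parking function $p$, maintain $P_r\in\mathbb Z^n$ ($P_1=p$) and an ordered list $O_r$ ($O_1$ empty), and produce letters $w_1,w_2,\dots$ (letters are symbols $\alpha_i^s$, $i\in[n]$, $s\in[0;m]$): Case 1: if $P_r$ has a zero entry, with $k$ the rightmost zero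 coordinate, $w_r=\alpha_k^0$, $P_{r+1}$ is $P_r$ with $1$ subtracted from coordinate $k$ and from every coordinate $i$ having positive entry and $0\in S^+_{i,k}$, and $O_{r+1}$ is $O_r$ with $k$ appended. Case 2: if $P_r$ has no zero entry and $O_r\ne\emptyset$, with $k$ the first element of $O_r$ and $-s$ the $k$-th entry of $P_r$, $w_r=\alpha_k^s$, $P_{r+1}$ is $P_r$ with $1$ subtracted from coordinate $k$ and from every coordinate $i$ having positive entry and $s\in S^+_{i,k}$, and $O_{r+1}$ is $O_r$ with its first element removed and $k$ appended at the end if $s<m$. When neither case applies the process stops and $\Psi(p)=w_1w_2\cdots$. For letters $a,b$ of $w$, $a<_w b$ means $a$ occurs before $b$ in $w$. -}

module Defs where

open import Data.Nat as ℕ using (ℕ; zero; suc; _<_; _⊔_)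
open import Data.Integer as ℤ using (ℤ; +_; -[1+_]; 0ℤ; _-_)
open import Data.Fin as Fin using (Fin)
open import Data.Fin.Properties using (_≟_)
open import Data.Fin.Subset using (Subset; Nonempty; _∈_; _∉_)
open import Data.Fin.Subset.Properties using (_∈?_)
open import Data.List using (List; []; _∷_; _++_; [_]; map; filter; length; allFin; concatMap; last; foldr; deduplicate)
import Data.List.Membership.DecPropositional as DecMem
open import Data.Nat.ListAction using (sum)
open import Data.Maybe using (Maybe; just; nothing)
open import Data.Product using (_×_; _,_; ∃; proj₁; proj₂)
open import Data.Bool using (Bool; true; false; if_then_else_)
open import Relation.Nullary using (does; ¬_)
open import Relation.Nullary.Decidable using (⌊_⌋; _×-dec_)

-- The family S = (S_{i,j})_{i<j} is given as a function Fin n → Fin n → List ℤ;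
-- only the values S i j with i < j are used.  A list represents the finite set
-- of its elements (duplicates are removed before counting).
Family : ℕ → Set
Family n = Fin n → Fin n → List ℤ

posPart : List ℤ → List ℕ
posPart [] = []
posPart (+ zero ∷ xs) = posPart xs
posPart (+ suc k ∷ xs) = suc k ∷ posPart xs
posPart (-[1+ k ] ∷ xs) = posPart xs

negPart : List ℤ → List ℕ
negPart [] = []
negPart (+ zero ∷ xs) = zero ∷ negPart xs
negPart (+ suc k ∷ xs) = negPart xs
negPart (-[1+ k ] ∷ xs) = suc k ∷ negPart xs

S⁺ : ∀ {n} → Family n → Fin n → Fin n → List ℕ
S⁺ S i j with Fin.compare i j
... | Fin.less _ _ = deduplicate ℕ._≟_ (posPart (S i j))
... | Fin.equal _ = []
... | Fin.greater _ _ = deduplicate ℕ._≟_ (negPart (S j i))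

open DecMem ℕ._≟_ using () renaming (_∈?_ to _∈ℕ?_)
open import Data.List.Membership.Propositional using () renaming (_∈_ to _∈ℕ_)

-- m = max of the union of all S⁺_{i,j} (0 if this union is empty)
maxS : ∀ {n} → Family n → ℕ
maxS {n} S = foldr _⊔_ 0 (concatMap (λ i → concatMap (λ j → S⁺ S i j) (allFin n)) (allFin n))

-- number of arcs (u,v) of D_S with v ∉ U (v ∈ [n+1]); the arc (u,n+1) always counts
outArcs : ∀ {n} → Family n → Subset n → Fin n → ℕ
outArcs {n} S U u =
  suc (sum (map (λ v → if does (v ∈? U) then 0 else length (S⁺ S u v)) (allFin n)))

IsParking : ∀ {n} → Family n → (Fin n → ℕ) → Set
IsParking {n} S p =
  (U : Subset n) → Nonempty U → ∃ λ u → u ∈ U × p u < outArcs S U u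

-- letters α_k^s are pairs (k , s)
Letter : ℕ → Set
Letter n = Fin n × ℕ

State : ℕ → Set
State n = (Fin n → ℤ) × List (Fin n)

initState : ∀ {n} → (Fin n → ℕ) → State n
initState p = (λ i → + p i) , []

update : ∀ {n} → Family n → (Fin n → ℤ) → Fin n → ℕ → Fin n → ℤ
update S P k s i =
  if does (i ≟ k) then P i - + 1
  else if ⌊ (ℤ.0ℤ ℤ.<? P i) ×-dec (s ∈ℕ? S⁺ S i k) ⌋ then P i - + 1
  else P i

-- one step of Ψ; nothing = the process stops
-- (Case 2 additionally stops if the k-th entry of P is positive, which cannot occur)
step : ∀ {n} → Family n → State n → Maybe (Letter n × State n)
step {n} S (P , O) with last (filter (λ i → P i ℤ.≟ 0ℤ) (allFin n))
... | just k = just ((k , 0) , (update S P k 0 , O ++ [ k ]))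
... | nothing with O
...   | [] = nothing
...   | k ∷ O' with P k
...     | + suc _ = nothing
...     | + zero = just ((k , 0) , (update S P k 0 , (if does (0 ℕ.<? maxS S) then O' ++ [ k ] else O')))
...     | -[1+ t ] = just ((k , suc t) , (update S P k (suc t) ,
                       (if does (suc t ℕ.<? maxS S) then O' ++ [ k ] else O')))

-- run r steps: returns the first r letters w_1 … w_r and the state (P_{r+1}, O_{r+1})
run : ∀ {n} → Family n → ℕ → State n → Maybe (List (Letter n) × State n)
run S zero st = just ([] , st)
run S (suc r) st with run S r st
... | nothing = nothing
... | just (ws , st') with step S st'
...   | nothing = nothing
...   | just (a , st'') = just (ws ++ [ a ] , st'')

countIn : ∀ {n} → Family n → Fin n → List (Letter n) → ℕ
countIn S i ws = length (filter (λ a → proj₂ a ∈ℕ? S⁺ S i (proj₁ a)) ws)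

-- A letter α_k^s lowers a coordinate i ≠ k exactly when
-- P i > 0 and s ∈ S⁺_{i,k}; the guard P i > 0 never matters for coordinates that
-- stay nonnegative, because a zero coordinate i ≠ k occurs only in Case 1, where
-- k is the rightmost zero, so i < k and 0 ∉ S⁺_{i,k}.  The letter's own
-- coordinate is ≤ 0 and becomes negative.  So each coordinate that is still
-- nonnegative has dropped by one for each letter α_j^t with t ∈ S⁺_{i,j}.
module Submission where

open import Defs
open import Data.Nat as ℕ using (ℕ; zero; suc)
open import Data.Integer as ℤ using (ℤ; +_; -[1+_]; _-_; _≤_; 0ℤ)
open import Data.Integer.Properties using (+-inverseʳ; +-identityʳ; pos-+; ≤-reflexive)
open import Data.Integer.Tactic.RingSolver using (solve-∀)
open import Data.Fin as Fin using (Fin)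
open import Data.Fin.Properties using (_≟_; toℕ-inject; toℕ<n; <-asym)
open import Data.List using (List; []; _∷_; _++_; [_]; filter; length; allFin; last)
open import Data.List.Properties using (filter-accept; filter-++; length-++)
open import Data.List.Membership.Propositional using (_∈_; _∉_)
open import Data.List.Membership.Propositional.Properties using (∈-filter⁺; ∈-filter⁻; ∈-deduplicate⁻; ∈-allFin)
import Data.List.Membership.DecPropositional as DecMembership
open import Data.List.Relation.Unary.Any using (here; there)
open import Data.List.Relation.Unary.All as All using ()
open import Data.List.Relation.Unary.AllPairs using (AllPairs; _∷_)
open import Data.List.Relation.Unary.AllPairs.Properties using (tabulate⁺-<)
open import Data.Maybe using (just; nothing)
open import Data.Maybe.Properties using (just-injective)
open import Data.Product using (_×_; _,_; proj₁; proj₂)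
open import Data.Sum using (_⊎_; inj₁; inj₂)
open import Data.Bool using (if_then_else_)
open import Function using (id; _∘_)
open import Relation.Nullary using (yes; no; does; ¬_; contradiction)
open import Relation.Unary using (Decidable)
open import Relation.Binary.PropositionalEquality using (_≡_; _≢_; refl; sym; trans; cong; subst; module ≡-Reasoning)

open DecMembership ℕ._≟_ using () renaming (_∈?_ to _∈ℕ?_)

module _ {A : Set} where

  last-∈ : ∀ (xs : List A) {x} → last xs ≡ just x → x ∈ xs
  last-∈ (x ∷ []) refl = here refl
  last-∈ (x ∷ y ∷ ys) eq = there (last-∈ (y ∷ ys) eq)

  last-nothing⇒[] : ∀ (xs : List A) → last xs ≡ nothing → xs ≡ []
  last-nothing⇒[] [] _ = refl
  last-nothing⇒[] (x ∷ y ∷ ys) eq with () ← last-nothing⇒[] (y ∷ ys) eq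

  last-∷-nonempty : ∀ {x y : A} {ys} → y ∈ ys → last (x ∷ ys) ≡ last ys
  last-∷-nonempty {ys = _ ∷ _} _ = refl

module _ {A : Set} {P : A → Set} (P? : Decidable P) where

  last-filter-∷ : ∀ {x y : A} {xs} → y ∈ filter P? xs → last (filter P? (x ∷ xs)) ≡ last (filter P? xs)
  last-filter-∷ {x} y∈ with P? x
  ... | yes _ = last-∷-nonempty y∈
  ... | no _ = refl

  last-filter-maximal : ∀ {R : A → A → Set} {xs k i} → AllPairs R xs →
                        last (filter P? xs) ≡ just k → i ∈ xs → P i → i ≡ k ⊎ R i k
  last-filter-maximal {xs = x ∷ xs} (_ ∷ sorted) eq (there i∈xs) Pi =
    last-filter-maximal sorted (trans (sym (last-filter-∷ {x} (∈-filter⁺ P? i∈xs Pi))) eq) i∈xs Pi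
  last-filter-maximal {R = R} {x ∷ xs} {k} (x<xs ∷ _) eq (here refl) Px
    with last (filter P? xs) in e
  ... | just k′ = inj₂ (subst (R x) k′≡k (All.lookup x<xs (proj₁ (∈-filter⁻ P? (last-∈ (filter P? xs) e)))))
    where
    k′≡k : k′ ≡ k
    k′≡k = just-injective (trans (sym e) (trans (sym (last-filter-∷ {x} (last-∈ (filter P? xs) e))) eq))
  ... | nothing = inj₁ (just-injective (begin
      just x                    ≡⟨ cong (λ ys → last (x ∷ ys)) (sym (last-nothing⇒[] (filter P? xs) e)) ⟩
      last (x ∷ filter P? xs)   ≡⟨ cong last (sym (filter-accept P? Px)) ⟩
      last (filter P? (x ∷ xs)) ≡⟨ eq ⟩
      just k                    ∎))
    where open ≡-Reasoning

inject< : ∀ {n} {i : Fin n} (j : Fin.Fin′ i) → Fin.inject j Fin.< i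
inject< {i = i} j = subst (ℕ._< Fin.toℕ i) (sym (toℕ-inject j)) (toℕ<n j)

0∉posPart : ∀ xs → 0 ∉ posPart xs
0∉posPart (+ zero ∷ xs) 0∈ = 0∉posPart xs 0∈
0∉posPart (+ suc _ ∷ xs) (there 0∈) = 0∉posPart xs 0∈
0∉posPart (-[1+ _ ] ∷ xs) 0∈ = 0∉posPart xs 0∈

0∉S⁺-< : ∀ {n} (S : Family n) {i k : Fin n} → i Fin.< k → 0 ∉ S⁺ S i k
0∉S⁺-< S {i} {k} i<k with Fin.compare i k
... | Fin.less _ _ = 0∉posPart (S i k) ∘ ∈-deduplicate⁻ ℕ._≟_ (posPart (S i k))
... | Fin.greater _ k<i = contradiction (inject< k<i) (<-asym i<k)

record SafeLetter {n} (S : Family n) (P : Fin n → ℤ) (k : Fin n) (s : ℕ) : Set where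
  field
    Pk≤0 : P k ≤ 0ℤ
    zero-untouched : ∀ {i} → P i ≡ 0ℤ → i ≢ k → s ∉ S⁺ S i k

isZero? : ∀ {n} (P : Fin n → ℤ) → Decidable (λ i → P i ≡ 0ℤ)
isZero? P i = P i ℤ.≟ 0ℤ

zeroIndices : ∀ {n} → (Fin n → ℤ) → List (Fin n)
zeroIndices {n} P = filter (isZero? P) (allFin n)

no-zero : ∀ {n} (P : Fin n → ℤ) → last (zeroIndices P) ≡ nothing → ∀ i → P i ≢ 0ℤ
no-zero P e i Pi≡0
  with () ← subst (i ∈_) (last-nothing⇒[] (zeroIndices P) e) (∈-filter⁺ (isZero? P) (∈-allFin i) Pi≡0)

rightmostZero-safe : ∀ {n} (S : Family n) (P : Fin n → ℤ) {k} → last (zeroIndices P) ≡ just k → SafeLetter S P k 0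
rightmostZero-safe {n} S P {k} e = record { Pk≤0 = ≤-reflexive Pk≡0 ; zero-untouched = untouched }
  where
  Pk≡0 : P k ≡ 0ℤ
  Pk≡0 = proj₂ (∈-filter⁻ (isZero? P) {xs = allFin n} (last-∈ (zeroIndices P) e))
  untouched : ∀ {i} → P i ≡ 0ℤ → i ≢ k → 0 ∉ S⁺ S i k
  untouched {i} Pi≡0 i≢k
    with last-filter-maximal (isZero? P) (tabulate⁺-< id) e (∈-allFin i) Pi≡0
  ... | inj₁ i≡k = contradiction i≡k i≢k
  ... | inj₂ i<k = 0∉S⁺-< S i<k

step-safe : ∀ {n} (S : Family n) P O {k s P′ O′} → step S (P , O) ≡ just ((k , s) , (P′ , O′)) →
            P′ ≡ update S P k s × SafeLetter S P k s
step-safe S P O eq with last (zeroIndices P) in e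
step-safe S P O refl | just k = refl , rightmostZero-safe S P e
step-safe S P O eq | nothing with O
step-safe S P O () | nothing | []
... | k ∷ O′ with P k in Pk
step-safe S P O () | nothing | k ∷ O′ | + suc _
step-safe S P O refl | nothing | k ∷ O′ | + zero = contradiction Pk (no-zero P e k)
step-safe S P O refl | nothing | k ∷ O′ | -[1+ t ] =
  refl , record { Pk≤0 = subst (_≤ 0ℤ) (sym Pk) ℤ.-≤+ ; zero-untouched = λ Pi≡0 _ → contradiction Pi≡0 (no-zero P e _) }

hits : ∀ {n} → Family n → Fin n → Letter n → ℕ
hits S i (k , s) = if does (s ∈ℕ? S⁺ S i k) then 1 else 0

counted? : ∀ {n} (S : Family n) (i : Fin n) → Decidable (λ (a : Letter n) → proj₂ a ∈ S⁺ S i (proj₁ a))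
counted? S i (k , s) = s ∈ℕ? S⁺ S i k

count-singleton : ∀ {n} (S : Family n) i (a : Letter n) → length (filter (counted? S i) [ a ]) ≡ hits S i a
count-singleton S i (k , s) with s ∈ℕ? S⁺ S i k
... | yes _ = refl
... | no _ = refl

countIn-snoc : ∀ {n} (S : Family n) i ws (a : Letter n) → countIn S i (ws ++ [ a ]) ≡ countIn S i ws ℕ.+ hits S i a
countIn-snoc S i ws a = begin
  length (filter (counted? S i) (ws ++ [ a ]))                 ≡⟨ cong length (filter-++ (counted? S i) ws [ a ]) ⟩
  length (filter (counted? S i) ws ++ filter (counted? S i) [ a ]) ≡⟨ length-++ (filter (counted? S i) ws) ⟩
  countIn S i ws ℕ.+ length (filter (counted? S i) [ a ])      ≡⟨ cong (countIn S i ws ℕ.+_) (count-singleton S i a) ⟩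
  countIn S i ws ℕ.+ hits S i a                                ∎
  where open ≡-Reasoning

≤0⇒pred-negative : ∀ {x} → x ≤ 0ℤ → ¬ (0ℤ ≤ x - + 1)
≤0⇒pred-negative { + zero } _ ()
≤0⇒pred-negative { + suc _ } (ℤ.+≤+ ()) _
≤0⇒pred-negative { -[1+ _ ] } _ ()

update-safe : ∀ {n} (S : Family n) P {k s} → SafeLetter S P k s → ∀ i → 0ℤ ≤ update S P k s i →
              0ℤ ≤ P i × update S P k s i ≡ P i - + hits S i (k , s)
update-safe S P {k} {s} safe i 0≤Pi′ with i ≟ k
... | yes refl = contradiction 0≤Pi′ (≤0⇒pred-negative (SafeLetter.Pk≤0 safe))
... | no i≢k with P i in Pi | s ∈ℕ? S⁺ S i k
...   | + zero | yes s∈ = contradiction s∈ (SafeLetter.zero-untouched safe Pi i≢k)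
...   | + zero | no _ = 0≤Pi′ , refl
...   | + suc m | yes _ = ℤ.+≤+ ℕ.z≤n , refl
...   | + suc m | no _ = 0≤Pi′ , sym (+-identityʳ (+ suc m))
...   | -[1+ m ] | _ = contradiction 0≤Pi′ λ ()

i-[j-k]≡i-j+k : ∀ (i j k : ℤ) → i - (j - k) ≡ (i - j) ℤ.+ k
i-[j-k]≡i-j+k = solve-∀

run-deficit : ∀ {n} (S : Family n) p r {ws P O} → run S r (initState p) ≡ just (ws , (P , O)) →
              ∀ i → 0ℤ ≤ P i → + p i - P i ≡ + countIn S i ws
run-deficit S p zero refl i _ = +-inverseʳ (+ p i)
run-deficit S p (suc r) eq i 0≤P′i with run S r (initState p) in ran
... | just (ws , (P , O)) with step S (P , O) in stepped
...   | just ((k , s) , (P′ , O′)) with refl ← eq with refl , safe ← step-safe S P O stepped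
  with 0≤Pi , P′i≡ ← update-safe S P safe i 0≤P′i = begin
  + p i - update S P k s i               ≡⟨ cong (+ p i -_) P′i≡ ⟩
  + p i - (P i - + h)                    ≡⟨ i-[j-k]≡i-j+k (+ p i) (P i) (+ h) ⟩
  (+ p i - P i) ℤ.+ + h                  ≡⟨ cong (ℤ._+ + h) (run-deficit S p r ran i 0≤Pi) ⟩
  + countIn S i ws ℤ.+ + h               ≡⟨ pos-+ (countIn S i ws) h ⟨
  + (countIn S i ws ℕ.+ h)               ≡⟨ cong +_ (countIn-snoc S i ws (k , s)) ⟨
  + countIn S i (ws ++ [ k , s ])        ∎
  where
  open ≡-Reasoning
  h : ℕ
  h = hits S i (k , s)

lemma3p5 : (n : ℕ) (S : Family n) (p : Fin n → ℕ) → IsParking S p →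
           (r : ℕ) (ws : List (Letter n)) (P : Fin n → ℤ) (O : List (Fin n))
           (a : Letter n) (st' : State n) →
           run S r (initState p) ≡ just (ws , (P , O)) →
           step S (P , O) ≡ just (a , st') →
           (i : Fin n) → 0ℤ ≤ P i →
           + p i - P i ≡ + countIn S i ws
lemma3p5 n S p _ r ws P O a st' ran _ = run-deficit S p r ran
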